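{- Let $G$ be a simple plane triangulation and let $u,v,w$ be vertices of $G$ with $uv,vw,wu\in E(G)$ such that the triangle $uvw$ is not a facial cycle of $G$. Then $d_G(u)+d_G(v)+d_G(w)\ge 18$, or $G$ contains a vertex of degree $3$.
   Context: A simple plane triangulation is a simple planar graph embedded in the sphere all of whose faces are triangles; $d_G(x)$ denotes the degree of $x$ in $G$. A facial cycle is the boundary cycle of a face of the embedding. -}

module Defs where

open import Data.Nat using (ℕ; zero; suc; _+_; _*_; _≤ᵇ_; _<ᵇ_)
open import Data.Bool using (Bool; true; false; if_then_else_; _∧_)
open import Data.Fin using (Fin; toℕ)
open import Data.List using (List; map; allFin; upTo; concatMap)
open import Data.Nat.ListAction using (sum)
open import Data.Bool.ListAction using (and)
open import Data.Product using (_×_; _,_; Σ; ∃; ∃-syntax)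
open import Data.Sum using (_⊎_)
open import Function using (_∘_)
open import Relation.Binary.PropositionalEquality using (_≡_)

iter : {A : Set} → (A → A) → ℕ → A → A
iter f zero    a = a
iter f (suc k) a = f (iter f k a)

countTrue : {A : Set} → (A → Bool) → List A → ℕ
countTrue p xs = sum (map (λ a → if p a then 1 else 0) xs)

-- A graph is given by a Boolean adjacency
-- function; an embedding in an orientable surface is given by a
-- rotation system: for each vertex x, `rot x` is a cyclic permutation
-- of the neighbourhood N(x) (the clockwise order of the edges at x).
-- Faces are the orbits of the face permutation on darts (ordered
-- adjacent pairs)  φ (x , y) = (y , rot y x).

Adj : {n : ℕ} → (Fin n → Fin n → Bool) → Fin n → Fin n → Set
Adj adj x y = adj x y ≡ true

data Reach {n : ℕ} (adj : Fin n → Fin n → Bool) (x : Fin n) : Fin n → Set where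
  here : Reach adj x x
  step : ∀ {y z} → Reach adj x y → Adj adj y z → Reach adj x z

module _ {n : ℕ} (adj : Fin n → Fin n → Bool) (rot : Fin n → Fin n → Fin n) where

  φ : Fin n × Fin n → Fin n × Fin n
  φ (x , y) = (y , rot y x)

  key : Fin n × Fin n → ℕ
  key (x , y) = toℕ x * n + toℕ y

  -- a dart is the representative of its face iff it is adjacent and has the
  -- least key in its φ-orbit (orbits have at most n*n elements)
  isFaceRep : Fin n × Fin n → Bool
  isFaceRep d@(x , y) =
    adj x y ∧ and (map (λ k → key d ≤ᵇ key (iter φ k d)) (upTo (n * n)))

  allPairs : List (Fin n × Fin n)
  allPairs = concatMap (λ x → map (λ y → (x , y)) (allFin n)) (allFin n)

  numFaces : ℕ
  numFaces = countTrue isFaceRep allPairs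

  numEdges : ℕ
  numEdges = countTrue (λ { (x , y) → (toℕ x <ᵇ toℕ y) ∧ adj x y }) allPairs

degree : {n : ℕ} → (Fin n → Fin n → Bool) → Fin n → ℕ
degree {n} adj x = countTrue (adj x) (allFin n)

-- A simple plane triangulation on the vertex set Fin n:
-- a connected simple graph with a rotation system whose surface has
-- Euler characteristic 2 (i.e. it is the sphere) and all of whose faces
-- are triangles (φ has order 3 on darts).
record PlaneTriangulation (n : ℕ) : Set where
  field
    adj       : Fin n → Fin n → Bool
    rot       : Fin n → Fin n → Fin n
    irrefl    : ∀ x → adj x x ≡ false
    sym       : ∀ x y → adj x y ≡ adj y x
    rot-closed : ∀ x y → Adj adj x y → Adj adj x (rot x y)
    rot-inj    : ∀ x y y' → Adj adj x y → Adj adj x y' → rot x y ≡ rot x y' → y ≡ y'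
    rot-cyclic : ∀ x y y' → Adj adj x y → Adj adj x y' → ∃[ k ] iter (rot x) k y ≡ y'
    connected : ∀ x y → Reach adj x y
    euler     : n + numFaces adj rot ≡ numEdges adj rot + 2
    triangular : ∀ x y → Adj adj x y → iter (φ adj rot) 3 (x , y) ≡ (x , y)

  -- the boundary cycle of the face of dart (x , y) is x , y , rot y x
  -- the triangle u v w is a facial cycle iff it is the boundary cycle of
  -- some face (up to rotation and reversal of the cyclic order)
  IsFacialTriangle : Fin n → Fin n → Fin n → Set
  IsFacialTriangle u v w =
    Σ (Fin n) λ x → Σ (Fin n) λ y → Adj adj x y ×
      ( ((x , y , rot y x) ≡ (u , v , w)) ⊎ ((x , y , rot y x) ≡ (v , w , u))
      ⊎ ((x , y , rot y x) ≡ (w , u , v)) ⊎ ((x , y , rot y x) ≡ (u , w , v))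
      ⊎ ((x , y , rot y x) ≡ (w , v , u)) ⊎ ((x , y , rot y x) ≡ (v , u , w)) )

  deg : Fin n → ℕ
  deg = degree adj

{-# OPTIONS --safe #-}
module Submission where

-- Around a vertex a the rotation rot a cycles through the neighbours of a; the angle at a from
-- b to c is the number of rotation steps from b to c.  The angles at a from b to c and from c to b
-- together count distinct neighbours, so their sum is at most deg a, and it suffices to show that
-- on each side of the non-facial triangle the three angles sum to at least 9 unless some vertex
-- has degree 3.  Every such angle is at least 2, since an angle 1 would make the triangle facial.
-- If the angle at a from b to c is exactly 2, the vertex x = rot a b lies on the faces a b x and
-- a x c.  Either the rotation at x is the 3-cycle a → b → c, so deg x = 3, or x b c is a triangle
-- whose angles at b and c are one smaller than those of a b c and again at least 2; if both are 2
-- then rot b c has degree 3, and otherwise the other two angles of a b c sum to at least 7.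

open import Defs
open import Data.Bool using (Bool; true; false; if_then_else_; _∧_; not)
open import Data.Bool.Properties using (∧-identityʳ; ∧-zeroʳ; ∧-conicalˡ; ¬-not)
open import Data.Fin using (Fin; zero; suc; _≟_)
open import Data.List using (List; []; _∷_; length; allFin)
open import Data.List.Membership.Propositional using (_∈_)
open import Data.List.Properties using (map-cong; map-tabulate)
open import Data.List.Relation.Unary.Any using (here; there)
open import Data.Nat using (ℕ; zero; suc; _+_; _∸_; _≤_; _<_; _≥_; z≤n; s≤s; _≤?_)
open import Data.Nat.ListAction using (sum)
open import Data.Nat.Properties
  using (≤-refl; ≤-reflexive; ≤-trans; ≤-<-trans; ≤-antisym; ≮⇒≥; ≰⇒>; <⇒≤; m≤n⇒m≤1+n;
         m<n⇒m<1+n; m≤n⇒m<n∨m≡n; m∸n≤m; m<n⇒0<n∸m; ∸-monoʳ-<; ∸-monoˡ-<; m∸n+n≡m; m+n∸m≡n;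
         m+[n∸m]≡n; +-suc; +-comm; +-mono-≤; module ≤-Reasoning)
open import Data.Nat.Tactic.RingSolver using (solve-∀)
open import Data.Product using (Σ; ∃; _×_; _,_; proj₁; proj₂)
open import Data.Sum using (_⊎_; inj₁; inj₂; map₁)
open import Function using (_∘_; case_of_)
open import Relation.Binary.PropositionalEquality
  using (_≡_; _≢_; refl; sym; trans; cong; subst; module ≡-Reasoning)
open import Relation.Nullary using (¬_; yes; no; does; contradiction)
open import Relation.Nullary.Decidable using (dec-true; dec-false)
open import Relation.Unary using (Decidable)

count : {n : ℕ} → (Fin n → Bool) → ℕ
count {n} p = countTrue p (allFin n)

countTrue-cong : {A : Set} {p q : A → Bool} → (∀ x → p x ≡ q x) →
                 (xs : List A) → countTrue p xs ≡ countTrue q xs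
countTrue-cong p≗q xs = cong sum (map-cong (λ x → cong (if_then 1 else 0) (p≗q x)) xs)

countTrue-none : {A : Set} {p : A → Bool} → (∀ x → p x ≡ false) →
                 (xs : List A) → countTrue p xs ≡ 0
countTrue-none none []       = refl
countTrue-none none (x ∷ xs) rewrite none x = countTrue-none none xs

count-suc : {n : ℕ} (p : Fin (suc n) → Bool) →
            count p ≡ (if p zero then 1 else 0) + count (λ i → p (suc i))
count-suc {n} p = cong ((if p zero then 1 else 0) +_) (cong sum
  (trans (map-tabulate suc indicator) (sym (map-tabulate (λ i → i) (indicator ∘ suc)))))
  where
  indicator : Fin (suc n) → ℕ
  indicator a = if p a then 1 else 0

_∖_ : {n : ℕ} → (Fin n → Bool) → Fin n → Fin n → Bool
(p ∖ t) s = p s ∧ not (does (s ≟ t))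

∖-self : {n : ℕ} (p : Fin n → Bool) (t : Fin n) → (p ∖ t) t ≡ false
∖-self p t rewrite dec-true (t ≟ t) refl = ∧-zeroʳ (p t)

∖-other : {n : ℕ} (p : Fin n → Bool) {s t : Fin n} → s ≢ t → (p ∖ t) s ≡ p s
∖-other p {s} {t} s≢t rewrite dec-false (s ≟ t) s≢t = ∧-identityʳ (p s)

count-∖ : {n : ℕ} (p : Fin n → Bool) (t : Fin n) → p t ≡ true → count p ≡ suc (count (p ∖ t))
count-∖ {suc n} p zero pt rewrite count-suc p | count-suc (p ∖ zero) | pt =
  cong suc (countTrue-cong (λ s → sym (∧-identityʳ (p (suc s)))) (allFin n))
count-∖ {suc n} p (suc t) pt rewrite count-suc p | count-suc (p ∖ suc t) | ∧-identityʳ (p zero) =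
  trans (cong (indicator +_) (count-∖ (λ i → p (suc i)) t pt)) (+-suc indicator _)
  where
  indicator : ℕ
  indicator = if p zero then 1 else 0

count-≥ : {n D : ℕ} (p : Fin n → Bool) (f : ℕ → Fin n) →
          (∀ {i} → i < D → p (f i) ≡ true) → (∀ {i j} → i < j → j < D → f i ≢ f j) →
          D ≤ count p
count-≥ {D = zero}  _ _ _ _ = z≤n
count-≥ {D = suc D} p f sat distinct rewrite count-∖ p (f D) (sat ≤-refl) =
  s≤s (count-≥ (p ∖ f D) f sat′ (λ i<j j<D → distinct i<j (m<n⇒m<1+n j<D)))
  where
  sat′ : ∀ {i} → i < D → (p ∖ f D) (f i) ≡ true
  sat′ i<D = trans (∖-other p (distinct i<D ≤-refl)) (sat (m<n⇒m<1+n i<D))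

count-≤-length : {n : ℕ} (p : Fin n → Bool) (xs : List (Fin n)) →
                 (∀ {s} → p s ≡ true → s ∈ xs) → count p ≤ length xs
count-≤-length {n} p [] covers =
  ≤-reflexive (countTrue-none {p = p} (λ s → ¬-not (λ ps → case covers ps of λ ())) (allFin n))
count-≤-length p (x ∷ xs) covers with p x in px
... | true rewrite count-∖ p x px = s≤s (count-≤-length (p ∖ x) xs covers′)
  where
  covers′ : ∀ {s} → (p ∖ x) s ≡ true → s ∈ xs
  covers′ {s} ps with covers (∧-conicalˡ (p s) _ ps)
  ... | here refl  = contradiction (trans (sym ps) (∖-self p s)) λ ()
  ... | there s∈xs = s∈xs
... | false = m≤n⇒m≤1+n (count-≤-length p xs covers′)
  where
  covers′ : ∀ {s} → p s ≡ true → s ∈ xs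
  covers′ ps with covers ps
  ... | here refl  = contradiction (trans (sym ps) px) λ ()
  ... | there s∈xs = s∈xs

iter-+ : {A : Set} (f : A → A) (m n : ℕ) (x : A) → iter f (m + n) x ≡ iter f m (iter f n x)
iter-+ f zero    n x = refl
iter-+ f (suc m) n x = cong f (iter-+ f m n x)

iter-∸ : {A : Set} (f : A → A) {m n : ℕ} (x : A) → n ≤ m → iter f (m ∸ n) (iter f n x) ≡ iter f m x
iter-∸ f {m} {n} x n≤m = trans (sym (iter-+ f (m ∸ n) n x)) (cong (λ k → iter f k x) (m∸n+n≡m n≤m))

record Minimal (P : ℕ → Set) (k : ℕ) : Set where
  field
    holds : P k
    below : ∀ {j} → j < k → ¬ P j

open Minimal public

minimal-exists : {P : ℕ → Set} → Decidable P → ∀ {K} → P K → ∃ (Minimal P)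
minimal-exists P? {zero} pK = 0 , record { holds = pK ; below = λ () }
minimal-exists P? {suc K} pK with P? 0
... | yes p0 = 0 , record { holds = p0 ; below = λ () }
... | no ¬p0 with k , min ← minimal-exists (P? ∘ suc) pK =
  suc k , record { holds = holds min
                 ; below = λ { {zero} _ → ¬p0 ; {suc j} (s≤s j<k) → below min j<k } }

IterDist : {A : Set} → (A → A) → A → A → ℕ → Set
IterDist f x y = Minimal (λ k → iter f k x ≡ y)

module _ {A : Set} {f : A → A} where

  no-return-within : ∀ {x y k l m} → IterDist f x y k → IterDist f y x l →
                     0 < m → m < k + l → iter f m x ≢ x
  no-return-within {x} {y} {k} {l} {m} d d′ 0<m m<k+l ret with m ≤? k
  ... | yes m≤k = below d (∸-monoʳ-< 0<m m≤k)
    (trans (cong (iter f (k ∸ m)) (sym ret)) (trans (iter-∸ f x m≤k) (holds d)))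
  ... | no m≰k = below d′ (≤-trans (∸-monoˡ-< m<k+l k≤m) (≤-reflexive (m+n∸m≡n k l)))
    (trans (cong (iter f (m ∸ k)) (sym (holds d))) (trans (iter-∸ f x k≤m) ret))
    where
    k≤m : k ≤ m
    k≤m = <⇒≤ (≰⇒> m≰k)

  iterDist-source-succ : ∀ {x x′ y k′ k} → f x ≡ x′ → x ≢ y →
                         IterDist f x′ y k′ → IterDist f x y k → suc k′ ≤ k
  iterDist-source-succ {k = zero} _ x≢y _ d = contradiction (holds d) x≢y
  iterDist-source-succ {x} {k = suc k} refl _ d′ d =
    s≤s (≮⇒≥ λ k<k′ → below d′ k<k′ (trans (iter-∸ f {suc k} x (s≤s z≤n)) (holds d)))

module InjectiveOn {A : Set} (P : A → Set) (f : A → A)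
                   (f-closed : ∀ {x} → P x → P (f x))
                   (f-injective : ∀ {x y} → P x → P y → f x ≡ f y → x ≡ y) where

  iter-closed : ∀ {x} k → P x → P (iter f k x)
  iter-closed zero    px = px
  iter-closed (suc k) px = f-closed (iter-closed k px)

  iter-cancel : ∀ {x y} k → P x → P y → iter f k x ≡ iter f k y → x ≡ y
  iter-cancel zero    px py eq = eq
  iter-cancel (suc k) px py eq =
    iter-cancel k px py (f-injective (iter-closed k px) (iter-closed k py) eq)

  iterDist-target-succ : ∀ {x z y k′ k} → f z ≡ y → x ≢ y → P x → P z →
                         IterDist f x z k′ → IterDist f x y k → suc k′ ≤ k
  iterDist-target-succ {k = zero} _ x≢y _ _ _ d = contradiction (holds d) x≢y
  iterDist-target-succ {k = suc k} refl _ px pz d′ d =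
    s≤s (≮⇒≥ λ k<k′ → below d′ k<k′ (f-injective (iter-closed k px) pz (holds d)))

  iterates-distinct : ∀ {x y k l i j} → P x → IterDist f x y k → IterDist f y x l →
                      i < j → j < k + l → iter f i x ≢ iter f j x
  iterates-distinct {x} {i = i} {j} px d d′ i<j j<k+l eq =
    no-return-within d d′ (m<n⇒0<n∸m i<j) (≤-<-trans (m∸n≤m j i) j<k+l)
      (sym (iter-cancel i px (iter-closed (j ∸ i) px) i-then-rest))
    where
    open ≡-Reasoning
    i-then-rest : iter f i x ≡ iter f i (iter f (j ∸ i) x)
    i-then-rest = begin
      iter f i x                  ≡⟨ eq ⟩
      iter f j x                  ≡⟨ cong (λ m → iter f m x) (sym (m+[n∸m]≡n (<⇒≤ i<j))) ⟩
      iter f (i + (j ∸ i)) x      ≡⟨ iter-+ f i (j ∸ i) x ⟩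
      iter f i (iter f (j ∸ i) x) ∎

≥2+≥2 : {X : Set} {m n : ℕ} → 2 ≤ m → 2 ≤ n → (m ≡ 2 → n ≡ 2 → X) → 5 ≤ m + n ⊎ X
≥2+≥2 2≤m 2≤n both with m≤n⇒m<n∨m≡n 2≤m | m≤n⇒m<n∨m≡n 2≤n
... | inj₂ refl | inj₂ refl = inj₂ (both refl refl)
... | inj₁ 3≤m  | _         = inj₁ (+-mono-≤ 3≤m 2≤n)
... | inj₂ refl | inj₁ 3≤n  = inj₁ (+-mono-≤ 2≤m 3≤n)

≥2+≥2+≥2 : {X : Set} {k₁ k₂ k₃ : ℕ} → 2 ≤ k₁ → 2 ≤ k₂ → 2 ≤ k₃ →
           (k₁ ≡ 2 → 7 ≤ k₂ + k₃ ⊎ X) → (k₂ ≡ 2 → 7 ≤ k₃ + k₁ ⊎ X) → (k₃ ≡ 2 → 7 ≤ k₁ + k₂ ⊎ X) →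
           9 ≤ k₁ + k₂ + k₃ ⊎ X
≥2+≥2+≥2 {k₁ = k₁} {k₂} {k₃} 2≤k₁ 2≤k₂ 2≤k₃ h₁ h₂ h₃
  with m≤n⇒m<n∨m≡n 2≤k₁ | m≤n⇒m<n∨m≡n 2≤k₂ | m≤n⇒m<n∨m≡n 2≤k₃
... | inj₂ refl | _         | _         = map₁ (s≤s ∘ s≤s) (h₁ refl)
... | inj₁ _    | inj₂ refl | _         =
  map₁ (λ 7≤ → subst (9 ≤_) (rearrange k₁ k₃) (s≤s (s≤s 7≤))) (h₂ refl)
  where
  rearrange : ∀ a b → 2 + (b + a) ≡ a + 2 + b
  rearrange = solve-∀
... | inj₁ _    | inj₁ _    | inj₂ refl =
  map₁ (λ 7≤ → subst (9 ≤_) (+-comm 2 (k₁ + k₂)) (s≤s (s≤s 7≤))) (h₃ refl)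
... | inj₁ 3≤k₁ | inj₁ 3≤k₂ | inj₁ 3≤k₃ = inj₁ (+-mono-≤ (+-mono-≤ 3≤k₁ 3≤k₂) 3≤k₃)

module _ {n : ℕ} (G : PlaneTriangulation n) where
  open PlaneTriangulation G renaming (sym to adj-sym)

  module Rotation (a : Fin n) =
    InjectiveOn (Adj adj a) (rot a) (λ {y} → rot-closed a y) (λ {y} {y′} → rot-inj a y y′)

  adj-flip : ∀ {x y} → Adj adj x y → Adj adj y x
  adj-flip {x} {y} xy = trans (adj-sym y x) xy

  adj⇒≢ : ∀ {x y} → Adj adj x y → x ≢ y
  adj⇒≢ {x} xy refl = contradiction (trans (sym xy) (irrefl x)) λ ()

  Face : Fin n → Fin n → Fin n → Set
  Face x y z = Adj adj x y × rot y x ≡ z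

  face-rotate : ∀ {x y z} → Face x y z → Face y z x
  face-rotate {x} {y} (xy , refl) = rot-closed y x (adj-flip xy) , cong proj₁ (triangular x y xy)

  Triangle : Fin n → Fin n → Fin n → Set
  Triangle a b c = Adj adj a b × Adj adj b c × Adj adj c a

  triangle-rotate : ∀ {a b c} → Triangle a b c → Triangle b c a
  triangle-rotate (ab , bc , ca) = bc , ca , ab

  Angle : Fin n → Fin n → Fin n → ℕ → Set
  Angle a = IterDist (rot a)

  HasDegree3 : Set
  HasDegree3 = Σ (Fin n) λ x → deg x ≡ 3

  angle-exists : ∀ {a b c} → Adj adj a b → Adj adj a c → ∃ (Angle a b c)
  angle-exists {a} {b} {c} ab ac with K , reaches ← rot-cyclic a b c ab ac =
    minimal-exists (λ k → iter (rot a) k b ≟ c) {K} reaches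

  angle≥2 : ∀ {a b c k} → Triangle a b c → ¬ Face b a c → Angle a b c k → 2 ≤ k
  angle≥2 {k = zero}        (_ , bc , _) _  θ = contradiction (holds θ) (adj⇒≢ bc)
  angle≥2 {k = suc zero}    (ab , _ , _) ¬F θ = contradiction (adj-flip ab , holds θ) ¬F
  angle≥2 {k = suc (suc k)} _            _  _ = s≤s (s≤s z≤n)

  angle+angle≤deg : ∀ {a b c k l} → Adj adj a b → Angle a b c k → Angle a c b l → k + l ≤ deg a
  angle+angle≤deg {a} {b} ab θ θ′ =
    count-≥ (adj a) (λ i → iter (rot a) i b) (λ {i} _ → Rotation.iter-closed a i ab)
      (Rotation.iterates-distinct a ab θ θ′)

  rotation-3-cycle⇒deg≡3 : ∀ {y a b c} → Adj adj y a → rot y a ≡ b → rot y b ≡ c → rot y c ≡ a →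
                           a ≢ b → b ≢ c → c ≢ a → deg y ≡ 3
  rotation-3-cycle⇒deg≡3 {y} {a} {b} {c} ya ya-b yb-c yc-a a≢b b≢c c≢a =
    ≤-antisym (count-≤-length (adj y) (a ∷ b ∷ c ∷ []) neighbour∈) (angle+angle≤deg ya θ θ′)
    where
    orbit∈ : ∀ k → iter (rot y) k a ∈ a ∷ b ∷ c ∷ []
    orbit∈ zero = here refl
    orbit∈ (suc k) with orbit∈ k
    ... | here e                 = there (here (trans (cong (rot y) e) ya-b))
    ... | there (here e)         = there (there (here (trans (cong (rot y) e) yb-c)))
    ... | there (there (here e)) = here (trans (cong (rot y) e) yc-a)

    neighbour∈ : ∀ {s} → adj y s ≡ true → s ∈ a ∷ b ∷ c ∷ []
    neighbour∈ {s} ys with k , e ← rot-cyclic y a s ya ys = subst (_∈ _) e (orbit∈ k)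

    θ : Angle y a c 2
    θ = record
      { holds = trans (cong (rot y) ya-b) yb-c
      ; below = λ { {zero} _ → c≢a ∘ sym
                  ; {suc zero} _ → b≢c ∘ trans (sym ya-b)
                  ; {suc (suc _)} (s≤s (s≤s ())) }
      }

    θ′ : Angle y c a 1
    θ′ = record { holds = yc-a ; below = λ { {zero} _ → c≢a ; {suc _} (s≤s ()) } }

  deg-rot≡3 : ∀ {a b c} → Triangle a b c → rot b (rot b c) ≡ a → rot c (rot c a) ≡ b →
              deg (rot b c) ≡ 3
  deg-rot≡3 {a} {b} {c} (ab , bc , ca) b-twice c-twice =
    rotation-3-cycle⇒deg≡3 (adj-flip (proj₁ F₂)) (proj₂ F₂) (proj₂ F₁) yc-a
      (adj⇒≢ ab) (adj⇒≢ bc) (adj⇒≢ ca)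
    where
    F₁ : Face b (rot b c) c
    F₁ = face-rotate (adj-flip bc , refl)
    F₂ : Face a (rot b c) b
    F₂ = face-rotate (face-rotate (adj-flip (proj₁ F₁) , b-twice))
    F₃ : Face c (rot c a) a
    F₃ = face-rotate (adj-flip ca , refl)
    F₄ : Face c b (rot c a)
    F₄ = face-rotate (adj-flip (proj₁ F₃) , c-twice)
    yc-a : rot (rot b c) c ≡ a
    yc-a = subst (λ t → rot t c ≡ a) (sym (proj₂ F₄)) (proj₂ F₃)

  opposite-angles≥7 : ∀ {a b c k₂ k₃} → Triangle a b c → ¬ Face b a c →
                      Angle a b c 2 → Angle b c a k₂ → Angle c a b k₃ → 7 ≤ k₂ + k₃ ⊎ HasDegree3
  opposite-angles≥7 {a} {b} {c} {k₂} {k₃} (ab , bc , ca) ¬F θ₁ θ₂ θ₃ = case rot x b ≟ c of λ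
    { (yes xb-c) → inj₂ (x , rotation-3-cycle⇒deg≡3 (adj-flip (proj₁ F₀)) (proj₂ F₀) xb-c (proj₂ F₃)
                               (adj⇒≢ ab) (adj⇒≢ bc) (adj⇒≢ ca))
    ; (no ¬xb-c) → inner-triangle (¬xb-c ∘ proj₂)
    }
    where
    x : Fin n
    x = rot a b
    F₀ : Face a x b
    F₀ = face-rotate (adj-flip ab , refl)
    F₁ : Face x b a
    F₁ = face-rotate F₀
    F₂ : Face a c x
    F₂ = face-rotate (adj-flip (proj₁ F₀) , holds θ₁)
    F₃ : Face c x a
    F₃ = face-rotate F₂
    T′ : Triangle x b c
    T′ = proj₁ F₁ , bc , proj₁ F₃
    T″ : Triangle c x b
    T″ = triangle-rotate (triangle-rotate T′)

    inner-triangle : ¬ Face b x c → 7 ≤ k₂ + k₃ ⊎ HasDegree3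
    inner-triangle ¬F′
      with k₂′ , θ₂′ ← angle-exists bc (adj-flip (proj₁ F₁))
         | k₃′ , θ₃′ ← angle-exists (proj₁ F₃) (adj-flip bc) =
      map₁ add-outer-steps
        (≥2+≥2 (angle≥2 (triangle-rotate T′) (¬F′ ∘ face-rotate) θ₂′)
               (angle≥2 T″ (¬F′ ∘ face-rotate ∘ face-rotate) θ₃′)
               λ { refl refl → rot b c , deg-rot≡3 T′ (holds θ₂′) (holds θ₃′) })
      where
      open ≤-Reasoning
      add-outer-steps : 5 ≤ k₂′ + k₃′ → 7 ≤ k₂ + k₃
      add-outer-steps 5≤ = begin
        7                   ≤⟨ s≤s (s≤s 5≤) ⟩
        2 + (k₂′ + k₃′)     ≡⟨ cong suc (sym (+-suc k₂′ k₃′)) ⟩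
        suc k₂′ + suc k₃′   ≤⟨ +-mono-≤ (Rotation.iterDist-target-succ b (proj₂ F₁) (adj⇒≢ ca)
                                                                     bc (adj-flip (proj₁ F₁)) θ₂′ θ₂)
                                        (iterDist-source-succ (proj₂ F₂) (adj⇒≢ ab) θ₃′ θ₃) ⟩
        k₂ + k₃             ∎

  angle-sum≥9 : ∀ {a b c k₁ k₂ k₃} → Triangle a b c → ¬ Face b a c →
                Angle a b c k₁ → Angle b c a k₂ → Angle c a b k₃ → 9 ≤ k₁ + k₂ + k₃ ⊎ HasDegree3
  angle-sum≥9 {a} {b} {c} T ¬F θ₁ θ₂ θ₃ =
    ≥2+≥2+≥2 (angle≥2 T ¬F θ₁) (angle≥2 T′ ¬F′ θ₂) (angle≥2 T″ ¬F″ θ₃)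
      (λ { refl → opposite-angles≥7 T ¬F θ₁ θ₂ θ₃ })
      (λ { refl → opposite-angles≥7 T′ ¬F′ θ₂ θ₃ θ₁ })
      (λ { refl → opposite-angles≥7 T″ ¬F″ θ₃ θ₁ θ₂ })
    where
    T′ : Triangle b c a
    T′ = triangle-rotate T
    T″ : Triangle c a b
    T″ = triangle-rotate T′
    ¬F′ : ¬ Face c b a
    ¬F′ = ¬F ∘ face-rotate
    ¬F″ : ¬ Face a c b
    ¬F″ = ¬F′ ∘ face-rotate

  degree-sum≥18 : ∀ {u v w} → Triangle u v w → ¬ Face v u w → ¬ Face w u v →
                  18 ≤ deg u + deg v + deg w ⊎ HasDegree3
  degree-sum≥18 {u} {v} {w} T@(uv , vw , wu) ¬F ¬F′
    with k₁ , θ₁ ← angle-exists uv (adj-flip wu)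
       | k₂ , θ₂ ← angle-exists vw (adj-flip uv)
       | k₃ , θ₃ ← angle-exists wu (adj-flip vw)
       | l₁ , φ₁ ← angle-exists (adj-flip wu) uv
       | l₂ , φ₂ ← angle-exists (adj-flip vw) wu
       | l₃ , φ₃ ← angle-exists (adj-flip uv) vw
    with angle-sum≥9 T ¬F θ₁ θ₂ θ₃
       | angle-sum≥9 (adj-flip wu , adj-flip vw , adj-flip uv) ¬F′ φ₁ φ₂ φ₃
  ... | inj₂ d | _      = inj₂ d
  ... | inj₁ _ | inj₂ d = inj₂ d
  ... | inj₁ 9≤k | inj₁ 9≤l = inj₁ (begin
    18                                 ≤⟨ +-mono-≤ 9≤k 9≤l ⟩
    (k₁ + k₂ + k₃) + (l₁ + l₂ + l₃)    ≡⟨ rearrange k₁ k₂ k₃ l₁ l₂ l₃ ⟩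
    (k₁ + l₁) + (k₂ + l₃) + (k₃ + l₂)  ≤⟨ +-mono-≤ (+-mono-≤ (angle+angle≤deg uv θ₁ φ₁)
                                                             (angle+angle≤deg vw θ₂ φ₃))
                                                   (angle+angle≤deg wu θ₃ φ₂) ⟩
    deg u + deg v + deg w              ∎)
    where
    open ≤-Reasoning
    rearrange : ∀ a b c d e f → (a + b + c) + (d + e + f) ≡ (a + d) + (b + f) + (c + e)
    rearrange = solve-∀

lemma4p2 : {n : ℕ} (G : PlaneTriangulation n) (u v w : Fin n) →
    let open PlaneTriangulation G in
    Adj adj u v → Adj adj v w → Adj adj w u → ¬ IsFacialTriangle u v w →
    (deg u + deg v + deg w ≥ 18) ⊎ (Σ (Fin n) λ x → deg x ≡ 3)
lemma4p2 G u v w uv vw wu ¬facial = degree-sum≥18 G (uv , vw , wu)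
  (λ (vu , e) → ¬facial (v , u , vu , inj₂ (inj₂ (inj₂ (inj₂ (inj₂ (cong (λ t → v , u , t) e)))))))
  (λ (wu′ , e) → ¬facial (w , u , wu′ , inj₂ (inj₂ (inj₁ (cong (λ t → w , u , t) e)))))
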